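{- Let $q>1$. The maximum, over all strategies, of the success probability in the New Hats-on-a-line Game with $q$ hat colours and two players is $1-\left(\frac{q-1}{q}\right)^{2}=\frac{2q-1}{q^2}$.
   Context: The New Hats-on-a-line Game with $q$ hat colours and $n$ players: players $P_1,\dots,P_n$ stand in a line. Each player receives a hat whose colour is chosen uniformly at random from a fixed set of $q$ colours, independently of the other hats. Player $P_i$ sees exactly the hats of $P_{i+1},\dots,P_n$ (not his own, nor those of $P_1,\dots,P_{i-1}$). The players respond one at a time in the order $P_1,P_2,\dots,P_n$; each response is either a guess of the player's own hat colour or a pass, and every player hears all earlier responses. Apart from agreeing on a strategy beforehand, no communication is allowed. A strategy specifies, for each player, the response as a function of the hats that player sees and the responses that player has heard. The players win if at least one player guesses correctly and no player guesses incorrectly; the success probability of a strategy is the probability of winning over the random hat assignment. -}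

module Defs where

open import Data.Nat using (ℕ; zero; suc; _+_; _*_)
open import Data.Integer using (+_)
open import Data.Rational using (ℚ; _/_; 0ℚ)
open import Data.Fin using (Fin; _≟_)
open import Data.Fin.Properties using ()
open import Data.Bool using (Bool; true; false; _∧_; _∨_; not; if_then_else_)
open import Data.List using (List; map)
open import Data.Nat.ListAction using (sum)
open import Data.List.Base using (allFin)
open import Relation.Nullary.Decidable using (⌊_⌋)

data Response (q : ℕ) : Set where
  pass  : Response q
  guess : Fin q → Response q

correct : ∀ {q} → Response q → Fin q → Bool
correct pass      c = false
correct (guess d) c = ⌊ d ≟ c ⌋

wrong : ∀ {q} → Response q → Fin q → Bool
wrong pass      c = false
wrong (guess d) c = not ⌊ d ≟ c ⌋

-- A strategy for the two-player game with q colours: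
-- P1 sees only P2's hat; P2 sees no hats and hears P1's response.
record Strategy (q : ℕ) : Set where
  field
    player1 : Fin q → Response q
    player2 : Response q → Response q
open Strategy public

wins : ∀ {q} → Strategy q → Fin q → Fin q → Bool
wins s c1 c2 =
  let r1 = player1 s c2
      r2 = player2 s r1
  in (correct r1 c1 ∨ correct r2 c2) ∧ not (wrong r1 c1 ∨ wrong r2 c2)

winCount : (q : ℕ) → Strategy q → ℕ
winCount q s =
  sum (map (λ c1 → sum (map (λ c2 → if wins s c1 c2 then 1 else 0) (allFin q))) (allFin q))

-- n / d as a rational number (only ever used with d ≠ 0; value 0 for d = 0).
frac : ℕ → ℕ → ℚ
frac n zero    = 0ℚ
frac n (suc d) = (+ n) / suc d

-- Success probability: hats are uniform and independent, so every one of
-- the q * q assignments has probability 1 / (q * q).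
successProb : (q : ℕ) → Strategy q → ℚ
successProb q s = frac (winCount q s) (q * q)

-- For each colour c₂ of P₂'s hat, look at the q assignments sharing it.  If P₁
-- guesses, he is right on at most one of them.  If P₁ passes, the outcome rests
-- on P₂'s answer to a pass, a single fixed colour, so the players win on all q
-- of them for that one colour of P₂ and on none otherwise.  Summing over c₂
-- gives at most q + (q − 1) = 2q − 1 wins out of q², and the strategy "P₁
-- passes exactly when P₂'s hat has colour 0, otherwise guesses 0; P₂ guesses 0
-- after a pass" attains it.
module Submission where

open import Defs
open import Data.Nat using (ℕ; _<_; _*_; _∸_)
open import Data.Rational using (_≤_)
open import Data.Product using (Σ-syntax; _×_)
open import Relation.Binary.PropositionalEquality using (_≡_)

open import Data.Nat as ℕ using (zero; suc; _+_; z≤n)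
import Data.Nat.Properties as ℕ
open import Data.Nat.Solver using (module +-*-Solver)
import Data.Integer as ℤ
import Data.Integer.Properties as ℤ
open import Data.Rational using (toℚᵘ)
import Data.Rational.Properties as ℚ
open import Data.Rational.Unnormalised using (mkℚᵘ; *≤*)
import Data.Rational.Unnormalised.Properties as ℚᵘ
open import Data.Fin as Fin using (Fin) renaming (_≟_ to _≟ᶠ_)
open import Data.Bool using (Bool; true; false; _∧_; _∨_; not; if_then_else_)
open import Data.List using (List; []; _∷_; map; length; allFin)
open import Data.List.Properties using (map-tabulate; length-tabulate; map-cong)
open import Data.Nat.ListAction using (sum)
open import Data.Bool.Properties using (not-involutive; ∧-idem; ∧-zeroʳ; ∨-identityʳ)
open import Data.Product using (_,_)
open import Function using (id; const; _∘_)
open import Relation.Nullary.Decidable using (⌊_⌋; yes; no)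
open import Relation.Binary.PropositionalEquality
  using (refl; sym; trans; cong; cong₂; module ≡-Reasoning)

frac-monoˡ-≤ : ∀ {m n} d → m ℕ.≤ n → frac m d ≤ frac n d
frac-monoˡ-≤ zero    m≤n = ℚ.≤-refl
frac-monoˡ-≤ {m} {n} (suc d) m≤n = ℚ.toℚᵘ-cancel-≤ (begin
  toℚᵘ (frac m (suc d)) ≃⟨ ℚ.toℚᵘ-fromℚᵘ (mkℚᵘ (ℤ.+ m) d) ⟩
  mkℚᵘ (ℤ.+ m) d          ≤⟨ *≤* (ℤ.*-monoʳ-≤-nonNeg (ℤ.+ suc d) (ℤ.+≤+ m≤n)) ⟩
  mkℚᵘ (ℤ.+ n) d          ≃⟨ ℚ.toℚᵘ-fromℚᵘ (mkℚᵘ (ℤ.+ n) d) ⟨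
  toℚᵘ (frac n (suc d)) ∎)
  where open ℚᵘ.≤-Reasoning

private variable A B : Set

∑ : List A → (A → ℕ) → ℕ
∑ xs f = sum (map f xs)

∑-mono-≤ : ∀ (xs : List A) {f g : A → ℕ} → (∀ x → f x ℕ.≤ g x) → ∑ xs f ℕ.≤ ∑ xs g
∑-mono-≤ []       f≤g = z≤n
∑-mono-≤ (x ∷ xs) f≤g = ℕ.+-mono-≤ (f≤g x) (∑-mono-≤ xs f≤g)

∑-const : ∀ (xs : List A) c → ∑ xs (const c) ≡ length xs * c
∑-const []       c = refl
∑-const (x ∷ xs) c = cong (c +_) (∑-const xs c)

∑-zero : ∀ (xs : List A) → ∑ xs (const 0) ≡ 0
∑-zero xs = trans (∑-const xs 0) (ℕ.*-zeroʳ (length xs))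

∑-distrib-+ : ∀ (xs : List A) (f g : A → ℕ) → ∑ xs (λ x → f x + g x) ≡ ∑ xs f + ∑ xs g
∑-distrib-+ []       f g = refl
∑-distrib-+ (x ∷ xs) f g = begin
  f x + g x + ∑ xs (λ y → f y + g y) ≡⟨ cong (f x + g x +_) (∑-distrib-+ xs f g) ⟩
  f x + g x + (∑ xs f + ∑ xs g)      ≡⟨ interchange (f x) (g x) (∑ xs f) (∑ xs g) ⟩
  f x + ∑ xs f + (g x + ∑ xs g)      ∎
  where
  open ≡-Reasoning
  open +-*-Solver
  interchange : ∀ a b c d → a + b + (c + d) ≡ a + c + (b + d)
  interchange = solve 4 (λ a b c d → a :+ b :+ (c :+ d) := a :+ c :+ (b :+ d)) refl

∑-distribˡ-* : ∀ (xs : List A) k (f : A → ℕ) → ∑ xs (λ x → k * f x) ≡ k * ∑ xs f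
∑-distribˡ-* []       k f = sym (ℕ.*-zeroʳ k)
∑-distribˡ-* (x ∷ xs) k f =
  trans (cong (k * f x +_) (∑-distribˡ-* xs k f)) (sym (ℕ.*-distribˡ-+ k (f x) (∑ xs f)))

∑-comm : ∀ (xs : List A) (ys : List B) (f : A → B → ℕ) →
  ∑ xs (λ x → ∑ ys (f x)) ≡ ∑ ys (λ y → ∑ xs (λ x → f x y))
∑-comm []       ys f = sym (∑-zero ys)
∑-comm (x ∷ xs) ys f = begin
  ∑ ys (f x) + ∑ xs (λ x′ → ∑ ys (f x′))             ≡⟨ cong (∑ ys (f x) +_) (∑-comm xs ys f) ⟩
  ∑ ys (f x) + ∑ ys (λ y → ∑ xs (λ x′ → f x′ y))     ≡⟨ ∑-distrib-+ ys (f x) _ ⟨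
  ∑ ys (λ y → f x y + ∑ xs (λ x′ → f x′ y))          ∎
  where open ≡-Reasoning

∑-allFin-const : ∀ n c → ∑ (allFin n) (const c) ≡ n * c
∑-allFin-const n c = trans (∑-const (allFin n) c) (cong (_* c) (length-tabulate {n = n} id))

∑-allFin-suc : ∀ n (f : Fin (suc n) → ℕ) → ∑ (allFin (suc n)) f ≡ f Fin.zero + ∑ (allFin n) (f ∘ Fin.suc)
∑-allFin-suc n f =
  cong (λ xs → f Fin.zero + sum xs) (trans (map-tabulate Fin.suc f) (sym (map-tabulate id (f ∘ Fin.suc))))

[_] : Bool → ℕ
[ b ] = if b then 1 else 0

[]≤1 : ∀ b → [ b ] ℕ.≤ 1
[]≤1 true  = ℕ.≤-refl
[]≤1 false = z≤n

∑-[≟] : ∀ {n} (d : Fin n) → ∑ (allFin n) (λ c → [ ⌊ d ≟ᶠ c ⌋ ]) ≡ 1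
∑-[≟] {suc n} Fin.zero    = trans (∑-allFin-suc n (λ c → [ ⌊ Fin.zero ≟ᶠ c ⌋ ])) (cong suc (∑-zero (allFin n)))
∑-[≟] {suc n} (Fin.suc d) = begin
  ∑ (allFin (suc n)) (λ c → [ ⌊ Fin.suc d ≟ᶠ c ⌋ ])     ≡⟨ ∑-allFin-suc n (λ c → [ ⌊ Fin.suc d ≟ᶠ c ⌋ ]) ⟩
  ∑ (allFin n) (λ c → [ ⌊ Fin.suc d ≟ᶠ Fin.suc c ⌋ ])  ≡⟨ cong sum (map-cong (λ c → cong [_] (suc≟suc d c)) (allFin n)) ⟩
  ∑ (allFin n) (λ c → [ ⌊ d ≟ᶠ c ⌋ ])                  ≡⟨ ∑-[≟] d ⟩
  1                                                    ∎
  where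
  open ≡-Reasoning
  suc≟suc : ∀ {n} (d c : Fin n) → ⌊ Fin.suc d ≟ᶠ Fin.suc c ⌋ ≡ ⌊ d ≟ᶠ c ⌋
  suc≟suc d c with d ≟ᶠ c
  ... | yes _ = refl
  ... | no  _ = refl

success : ∀ {q} → Response q → Response q → Fin q → Fin q → Bool
success r₁ r₂ c₁ c₂ = (correct r₁ c₁ ∨ correct r₂ c₂) ∧ not (wrong r₁ c₁ ∨ wrong r₂ c₂)

correct∧¬wrong : ∀ {q} (r : Response q) c → correct r c ∧ not (wrong r c) ≡ correct r c
correct∧¬wrong pass      c = refl
correct∧¬wrong (guess d) c = trans (cong (⌊ d ≟ᶠ c ⌋ ∧_) (not-involutive _)) (∧-idem _)

success-pass : ∀ {q} (r₂ : Response q) c₁ c₂ → success pass r₂ c₁ c₂ ≡ correct r₂ c₂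
success-pass r₂ c₁ c₂ = correct∧¬wrong r₂ c₂

success-guess-pass : ∀ {q} (d : Fin q) c₁ c₂ → success (guess d) pass c₁ c₂ ≡ correct (guess d) c₁
success-guess-pass d c₁ c₂ =
  trans (cong₂ (λ x y → x ∧ not y) (∨-identityʳ (correct (guess d) c₁)) (∨-identityʳ (wrong (guess d) c₁)))
        (correct∧¬wrong (guess d) c₁)

success-guess-≤ : ∀ {q} (d : Fin q) r₂ c₁ c₂ → [ success (guess d) r₂ c₁ c₂ ] ℕ.≤ [ correct (guess d) c₁ ]
success-guess-≤ d r₂ c₁ c₂ with ⌊ d ≟ᶠ c₁ ⌋
... | true  = []≤1 _
... | false = ℕ.≤-reflexive (cong [_] (∧-zeroʳ (correct r₂ c₂)))

∑-correct-≤1 : ∀ {q} (r : Response q) → ∑ (allFin q) (λ c → [ correct r c ]) ℕ.≤ 1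
∑-correct-≤1 {q} pass      = ℕ.≤-trans (ℕ.≤-reflexive (∑-zero (allFin q))) z≤n
∑-correct-≤1     (guess d) = ℕ.≤-reflexive (∑-[≟] d)

column-≤ : ∀ k (r₁ : Response (suc k)) (react : Response (suc k) → Response (suc k)) c₂ →
  ∑ (allFin (suc k)) (λ c₁ → [ success r₁ (react r₁) c₁ c₂ ]) ℕ.≤ 1 + k * [ correct (react pass) c₂ ]
column-≤ k pass react c₂ = begin
  ∑ (allFin (suc k)) (λ c₁ → [ success pass (react pass) c₁ c₂ ])
    ≡⟨ cong sum (map-cong (λ c₁ → cong [_] (success-pass (react pass) c₁ c₂)) (allFin (suc k))) ⟩
  ∑ (allFin (suc k)) (const b)   ≡⟨ ∑-allFin-const (suc k) b ⟩
  b + k * b                      ≤⟨ ℕ.+-monoˡ-≤ (k * b) ([]≤1 (correct (react pass) c₂)) ⟩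
  1 + k * b                      ∎
  where
  open ℕ.≤-Reasoning
  b = [ correct (react pass) c₂ ]
column-≤ k (guess d) react c₂ = begin
  ∑ (allFin (suc k)) (λ c₁ → [ success (guess d) (react (guess d)) c₁ c₂ ])
    ≤⟨ ∑-mono-≤ (allFin (suc k)) (λ c₁ → success-guess-≤ d (react (guess d)) c₁ c₂) ⟩
  ∑ (allFin (suc k)) (λ c₁ → [ correct (guess d) c₁ ]) ≤⟨ ∑-correct-≤1 (guess d) ⟩
  1                                                   ≤⟨ ℕ.m≤m+n 1 _ ⟩
  1 + k * [ correct (react pass) c₂ ]                 ∎
  where open ℕ.≤-Reasoning

winCount-by-columns : ∀ {q} (s : Strategy q) →
  winCount q s ≡ ∑ (allFin q) (λ c₂ → ∑ (allFin q) (λ c₁ → [ wins s c₁ c₂ ]))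
winCount-by-columns {q} s = ∑-comm (allFin q) (allFin q) (λ c₁ c₂ → [ wins s c₁ c₂ ])

[1+k]*1+k*1≡2*[1+k]∸1 : ∀ k → suc k * 1 + k * 1 ≡ 2 * suc k ∸ 1
[1+k]*1+k*1≡2*[1+k]∸1 = solve 1 (λ k → (con 1 :+ k) :* con 1 :+ k :* con 1 := k :+ ((con 1 :+ k) :+ con 0)) refl
  where open +-*-Solver

winCount-≤ : ∀ {q} (s : Strategy q) → winCount q s ℕ.≤ 2 * q ∸ 1
winCount-≤ {zero}  s = z≤n
winCount-≤ {suc k} s = begin
  winCount q s
    ≡⟨ winCount-by-columns s ⟩
  ∑ (allFin q) (λ c₂ → ∑ (allFin q) (λ c₁ → [ wins s c₁ c₂ ]))
    ≤⟨ ∑-mono-≤ (allFin q) (λ c₂ → column-≤ k (player1 s c₂) (player2 s) c₂) ⟩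
  ∑ (allFin q) (λ c₂ → 1 + k * b c₂)
    ≡⟨ ∑-distrib-+ (allFin q) (const 1) (λ c₂ → k * b c₂) ⟩
  ∑ (allFin q) (const 1) + ∑ (allFin q) (λ c₂ → k * b c₂)
    ≡⟨ cong₂ _+_ (∑-allFin-const q 1) (∑-distribˡ-* (allFin q) k b) ⟩
  q * 1 + k * ∑ (allFin q) b
    ≤⟨ ℕ.+-monoʳ-≤ (q * 1) (ℕ.*-monoʳ-≤ k (∑-correct-≤1 (player2 s pass))) ⟩
  q * 1 + k * 1
    ≡⟨ [1+k]*1+k*1≡2*[1+k]∸1 k ⟩
  2 * q ∸ 1 ∎
  where
  open ℕ.≤-Reasoning
  q = suc k
  b : Fin q → ℕ
  b c₂ = [ correct (player2 s pass) c₂ ]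

optimal : ∀ k → Strategy (suc k)
optimal k = record { player1 = signal ; player2 = answer }
  where
  signal : Fin (suc k) → Response (suc k)
  signal Fin.zero    = pass
  signal (Fin.suc _) = guess Fin.zero
  answer : Response (suc k) → Response (suc k)
  answer pass      = guess Fin.zero
  answer (guess _) = pass

winCount-optimal : ∀ k → winCount (suc k) (optimal k) ≡ 2 * suc k ∸ 1
winCount-optimal k = begin
  winCount q (optimal k)
    ≡⟨ winCount-by-columns (optimal k) ⟩
  ∑ (allFin q) (λ c₂ → column c₂)
    ≡⟨ ∑-allFin-suc k column ⟩
  column Fin.zero + ∑ (allFin k) (λ j → column (Fin.suc j))
    ≡⟨ cong₂ _+_ (∑-allFin-const q 1) (trans (cong sum (map-cong column-suc (allFin k))) (∑-allFin-const k 1)) ⟩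
  q * 1 + k * 1
    ≡⟨ [1+k]*1+k*1≡2*[1+k]∸1 k ⟩
  2 * q ∸ 1 ∎
  where
  open ≡-Reasoning
  q = suc k
  column : Fin q → ℕ
  column c₂ = ∑ (allFin q) (λ c₁ → [ wins (optimal k) c₁ c₂ ])
  column-suc : ∀ j → column (Fin.suc j) ≡ 1
  column-suc j = trans
    (cong sum (map-cong (λ c₁ → cong [_] (success-guess-pass Fin.zero c₁ (Fin.suc j))) (allFin q)))
    (∑-[≟] {q} Fin.zero)

theorem3 : (q : ℕ) → 1 < q →
    (Σ[ s ∈ Strategy q ] successProb q s ≡ frac (2 * q ∸ 1) (q * q))
    × ((s : Strategy q) → successProb q s ≤ frac (2 * q ∸ 1) (q * q))
theorem3 zero    ()
theorem3 (suc k) _ =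
  (optimal k , cong (λ w → frac w (suc k * suc k)) (winCount-optimal k)) ,
  (λ s → frac-monoˡ-≤ (suc k * suc k) (winCount-≤ s))
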